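{- For a positive integer $n$, let $\alpha_n=\Diamond\Box\perp\wedge\Diamond^n\Box\perp$, where $\Diamond^0\psi=\psi$ and $\Diamond^{k+1}\psi=\Diamond\Diamond^k\psi$. Then $\neg\alpha_n\in L_0$ if, and only if, $n$ is even.
   Context: Predicate modal formulas use countably many predicate letters of each arity, $\neg,\wedge,\Box,\forall$, with $\Diamond=\neg\Box\neg$ and $\perp$ a contradiction. A frame is $\langle W,R\rangle$, $W\neq\emptyset$; predicate frames assign nonempty expanding domains ($wRw'\Rightarrow D(w)\subseteq D(w')$), models interpret letters at each world over its domain, $\Box$ quantifies over $R$-successors. A formula is valid on a frame if true at all worlds under all assignments in all models over all predicate frames over it. For $n\geqslant 1$, $\mathfrak{F}_n=\langle W_n,R_n\rangle$ with $W_n=\{w_1,\dots,w_n,w^\ast\}$, $R_n=\{\langle w_i,w_{i+1}\rangle:1\leqslant i<n\}\cup\{\langle w_1,w^\ast\rangle\}$. $L_0$ is the set of formulas valid on every $\mathfrak{F}_{2n}$, $n\geqslant 1$. -}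

module Defs where

open import Data.Nat using (ℕ; zero; suc; _≤_; _*_)
open import Data.Nat.Properties using (_≟_)
open import Data.Fin using (Fin; toℕ)
open import Data.Maybe using (Maybe; just; nothing)
open import Data.Product using (Σ; _×_)
open import Relation.Binary.PropositionalEquality using (_≡_)
open import Relation.Nullary using (¬_; yes; no)

Var : Set
Var = ℕ

-- Predicate modal formulas: countably many predicate letters P^k_i of each arity k.
data Formula : Set where
  pred : (k : ℕ) → (i : ℕ) → (Fin k → Var) → Formula
  ~_   : Formula → Formula
  _∧_  : Formula → Formula → Formula
  □_   : Formula → Formula
  ∀′   : Var → Formula → Formula

infixr 6 _∧_
infix 7 ~_ □_ ◇_

◇_ : Formula → Formula
◇ φ = ~ (□ (~ φ))

⊥′ : Formula
⊥′ = pred 0 0 (λ ()) ∧ ~ pred 0 0 (λ ())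

◇^ : ℕ → Formula → Formula
◇^ zero    ψ = ψ
◇^ (suc k) ψ = ◇ (◇^ k ψ)

α : ℕ → Formula
α n = ◇ (□ ⊥′) ∧ ◇^ n (□ ⊥′)

record Frame : Set₁ where
  field
    W     : Set
    R     : W → W → Set
    point : W

-- Predicate frames over a frame: domains as subsets D w of a carrier U,
-- nonempty and expanding along R.  A model adds an interpretation of every
-- predicate letter at every world (only its values on D w matter).
record PredModel (F : Frame) : Set₁ where
  open Frame F
  field
    U         : Set
    D         : W → U → Set
    nonempty  : (w : W) → Σ U (D w)
    expanding : (w w′ : W) → R w w′ → (u : U) → D w u → D w′ u
    I         : W → (k : ℕ) → ℕ → (Fin k → U) → Set

module _ {F : Frame} (M : PredModel F) where
  open Frame F
  open PredModel M

  _[_↦_] : (Var → U) → Var → U → (Var → U)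
  (g [ x ↦ d ]) y with y ≟ x
  ... | yes _ = d
  ... | no  _ = g y

  Sat : W → (Var → U) → Formula → Set
  Sat w g (pred k i xs) = I w k i (λ j → g (xs j))
  Sat w g (~ φ)         = ¬ Sat w g φ
  Sat w g (φ ∧ ψ)       = Sat w g φ × Sat w g ψ
  Sat w g (□ φ)         = (w′ : W) → R w w′ → Sat w′ g φ
  Sat w g (∀′ x φ)      = (d : U) → D w d → Sat w (g [ x ↦ d ]) φ

ValidOn : Frame → Formula → Set₁
ValidOn F φ = (M : PredModel F) (w : Frame.W F) (g : Var → PredModel.U M) →
              ((x : Var) → PredModel.D M w (g x)) → Sat M w g φ

-- The frames 𝔉_n: worlds just i ≙ w_{i+1} (i : Fin n), nothing ≙ w*.
data R𝔉 (n : ℕ) : Maybe (Fin n) → Maybe (Fin n) → Set where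
  step : (i j : Fin n) → toℕ j ≡ suc (toℕ i) → R𝔉 n (just i) (just j)
  star : (i : Fin n) → toℕ i ≡ 0 → R𝔉 n (just i) nothing

𝔉 : ℕ → Frame
𝔉 n = record { W = Maybe (Fin n) ; R = R𝔉 n ; point = nothing }

L₀ : Formula → Set₁
L₀ φ = (m : ℕ) → 1 ≤ m → ValidOn (𝔉 (2 * m)) φ

-- Proof idea.  □⊥ holds exactly at dead ends, so ◇^k □⊥ says that some path
-- of exactly k steps ends in a dead end; this reading of the formula is
-- independent of domains and interpretations ('DeadEnds' below).  In 𝔉_N the
-- only dead ends are w* (reached in one step, from w₁ only) and w_N (reached
-- in k steps from w_{i+1} exactly when i + k + 1 = N).  Hence:
--   * if n ≠ 1 and n + 1 ≠ N, no world of 𝔉_N satisfies α_n, so ¬α_n is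
--     valid on 𝔉_N ('not-α-valid');
--   * if n ≥ 1, the world w₁ of 𝔉_{n+1} satisfies α_n in every model
--     ('α-satisfiable'), so ¬α_n is not valid there.
-- For even n both hypotheses of the first item hold for every N = 2m, which
-- gives ¬α_n ∈ L₀.  For odd n the frame 𝔉_{n+1} is one of the frames 𝔉_{2m}
-- defining L₀, so the second item refutes ¬α_n ∈ L₀.
module Submission where

open import Defs
open import Data.Nat using (ℕ; _≤_)
open import Data.Nat.Divisibility using (_∣_)
open import Function.Bundles using (_⇔_)

open import Data.Nat using (zero; suc; _+_; _*_; _<_; z≤n; s≤s; _≤?_)
open import Data.Nat.Properties
  using (+-suc; +-comm; +-identityʳ; +-cancelˡ-≡; *-comm; suc-injective; 1+n≢0;
         m≤m+n; ≤-trans; ≤-reflexive; ≤-antisym; ≤-pred; ≰⇒>; <-irrefl; <⇒≢)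
open import Data.Nat.Divisibility
  using (divides; ∣-refl; ∣m∣n⇒∣m+n; ∣m+n∣m⇒∣n; ∣1⇒≡1; m∣m*n)
open import Data.Fin using (Fin; toℕ; fromℕ<) renaming (zero to fzero)
open import Data.Fin.Properties using (toℕ<n; toℕ-fromℕ<)
open import Data.Maybe using (just; nothing)
open import Data.Product using (Σ; _×_; _,_; proj₁; proj₂)
open import Data.Sum using (_⊎_; inj₁; inj₂)
open import Data.Empty using (⊥; ⊥-elim)
open import Data.Unit using (⊤; tt)
open import Relation.Nullary using (¬_; yes; no)
open import Relation.Binary.PropositionalEquality
  using (_≡_; _≢_; refl; sym; trans; cong; subst)
open import Function.Bundles using (mk⇔)

module DeadEnds (F : Frame) where
  open Frame F

  DeadEnd : W → Set
  DeadEnd w = (w′ : W) → ¬ R w w′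

  Terminates : ℕ → W → Set
  Terminates zero    w = DeadEnd w
  Terminates (suc k) w = Σ W λ w′ → R w w′ × Terminates k w′

  -- If ◇^k □⊥ holds at w, such a path cannot fail to exist.  (Only the
  -- double negation is available: ◇ is defined as ¬□¬.)
  ◇^□⊥⇒¬¬Terminates : (M : PredModel F) (g : Var → PredModel.U M) (k : ℕ)
                      (w : W) → Sat M w g (◇^ k (□ ⊥′)) → ¬ ¬ Terminates k w
  ◇^□⊥⇒¬¬Terminates M g zero    w □⊥ no-path =
    no-path λ w′ r → let contradiction = □⊥ w′ r in
                     proj₂ contradiction (proj₁ contradiction)
  ◇^□⊥⇒¬¬Terminates M g (suc k) w ◇φ no-path =
    ◇φ λ w′ r φ → ◇^□⊥⇒¬¬Terminates M g k w′ φ λ t → no-path (w′ , r , t)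

  Terminates⇒◇^□⊥ : (M : PredModel F) (g : Var → PredModel.U M) (k : ℕ)
                    (w : W) → Terminates k w → Sat M w g (◇^ k (□ ⊥′))
  Terminates⇒◇^□⊥ M g zero    w dead         w′ r = ⊥-elim (dead w′ r)
  Terminates⇒◇^□⊥ M g (suc k) w (w′ , r , t) ¬φ   =
    ¬φ w′ r (Terminates⇒◇^□⊥ M g k w′ t)

not-last : {a k N : ℕ} → suc (a + suc k) ≡ N → suc a < N
not-last {a} {k} a+k+2≡N =
  ≤-trans (s≤s (s≤s (m≤m+n a k)))
          (≤-reflexive (trans (cong suc (sym (+-suc a k))) a+k+2≡N))

module PathsIn𝔉 (N : ℕ) where
  open DeadEnds (𝔉 N) public

  w*-dead-end : DeadEnd nothing
  w*-dead-end _ ()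

  successor : (i : Fin N) → suc (toℕ i) < N →
              Σ (Fin N) λ j → R𝔉 N (just i) (just j) × toℕ j ≡ suc (toℕ i)
  successor i i+2≤N = j , step i j (toℕ-fromℕ< i+2≤N) , toℕ-fromℕ< i+2≤N
    where
    j : Fin N
    j = fromℕ< i+2≤N

  dead-end⇒last : (i : Fin N) → DeadEnd (just i) → suc (toℕ i) ≡ N
  dead-end⇒last i dead with suc (suc (toℕ i)) ≤? N
  ... | yes i+2≤N = let j , r , _ = successor i i+2≤N in ⊥-elim (dead (just j) r)
  ... | no  i+2≰N = ≤-antisym (toℕ<n i) (≤-pred (≰⇒> i+2≰N))

  -- w_N is a dead end, provided it is not w₁ (which sees w*).
  last⇒dead-end : (i : Fin N) → suc (toℕ i) ≡ N → 1 ≤ toℕ i → DeadEnd (just i)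
  last⇒dead-end i last _ (just j) (step .i .j j≡i+1) =
    <-irrefl (trans j≡i+1 last) (toℕ<n j)
  last⇒dead-end i _ 1≤i nothing (star .i i≡0) = <⇒≢ 1≤i (sym i≡0)

  terminates-from-chain : (k : ℕ) (i : Fin N) → Terminates k (just i) →
                          (k ≡ 1 × toℕ i ≡ 0) ⊎ suc (toℕ i + k) ≡ N
  terminates-from-chain zero i dead =
    inj₂ (trans (cong suc (+-identityʳ (toℕ i))) (dead-end⇒last i dead))
  terminates-from-chain (suc zero) i (nothing , star .i i≡0 , _) = inj₁ (refl , i≡0)
  terminates-from-chain (suc (suc k)) i (nothing , star .i _ , w* , () , _)
  terminates-from-chain (suc k) i (just j , step .i .j j≡i+1 , t)
    with terminates-from-chain k j t
  ... | inj₁ (_ , j≡0) = ⊥-elim (1+n≢0 (trans (sym j≡i+1) j≡0))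
  ... | inj₂ j+k+1≡N   = inj₂ (trans (cong suc (+-suc (toℕ i) k))
                                     (subst (λ x → suc (x + k) ≡ N) j≡i+1 j+k+1≡N))

  chain-terminates : (k : ℕ) (i : Fin N) → suc (toℕ i + k) ≡ N → 1 ≤ toℕ i + k →
                     Terminates k (just i)
  chain-terminates zero i i+1≡N 1≤i+0 =
    last⇒dead-end i (trans (cong suc (sym (+-identityʳ (toℕ i)))) i+1≡N)
                    (subst (1 ≤_) (+-identityʳ (toℕ i)) 1≤i+0)
  chain-terminates (suc k) i i+k+2≡N _ with successor i (not-last i+k+2≡N)
  ... | j , r , j≡i+1 =
    just j , r , chain-terminates k j j+k+1≡N (subst (λ x → 1 ≤ x + k) (sym j≡i+1) (s≤s z≤n))
    where
    j+k+1≡N : suc (toℕ j + k) ≡ N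
    j+k+1≡N = trans (cong (λ x → suc (x + k)) j≡i+1)
                    (trans (cong suc (sym (+-suc (toℕ i) k))) i+k+2≡N)

trivial-model : (N : ℕ) → PredModel (𝔉 N)
trivial-model N = record
  { U = ⊤ ; D = λ _ _ → ⊤ ; nonempty = λ _ → tt , tt
  ; expanding = λ _ _ _ _ _ → tt ; I = λ _ _ _ _ → ⊤ }

-- ¬α_n is valid on 𝔉_N whenever n ≠ 1 and n + 1 ≠ N: a world satisfying
-- α_n would start a 1-step and an n-step dead-end path, and the
-- classification of such paths then forces n = 1 or n + 1 = N.
not-α-valid : (N n : ℕ) → n ≢ 1 → suc n ≢ N → ValidOn (𝔉 N) (~ α n)
not-α-valid N n n≢1 n+1≢N M w g _ (◇□⊥ , ◇ⁿ□⊥) =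
  ◇^□⊥⇒¬¬Terminates M g 1 w ◇□⊥ λ t₁ →
  ◇^□⊥⇒¬¬Terminates M g n w ◇ⁿ□⊥ λ tₙ →
  no-world-satisfies-α w t₁ tₙ
  where
  open PathsIn𝔉 N
  no-world-satisfies-α : (w : Frame.W (𝔉 N)) → Terminates 1 w → Terminates n w → ⊥
  no-world-satisfies-α nothing (w′ , r , _) _ = w*-dead-end w′ r
  no-world-satisfies-α (just i) t₁ tₙ
    with terminates-from-chain 1 i t₁ | terminates-from-chain n i tₙ
  ... | _                   | inj₁ (n≡1 , _) = n≢1 n≡1
  ... | inj₁ (_ , i≡0)      | inj₂ i+n+1≡N  =
    n+1≢N (subst (λ x → suc (x + n) ≡ N) i≡0 i+n+1≡N)
  ... | inj₂ i+1+1≡N        | inj₂ i+n+1≡N  =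
    n≢1 (sym (+-cancelˡ-≡ (toℕ i) 1 n (suc-injective (trans i+1+1≡N (sym i+n+1≡N)))))

-- For n ≥ 1, α_n holds at w₁ in 𝔉_{n+1}: w* is one step away and the
-- dead end w_{n+1} is n steps away.
α-satisfiable : (n : ℕ) → 1 ≤ n → ¬ ValidOn (𝔉 (suc n)) (~ α n)
α-satisfiable n 1≤n valid =
  valid M (just fzero) g (λ _ → tt)
    ( Terminates⇒◇^□⊥ M g 1 (just fzero) (nothing , star fzero refl , w*-dead-end)
    , Terminates⇒◇^□⊥ M g n (just fzero) (chain-terminates n fzero refl 1≤n) )
  where
  open PathsIn𝔉 (suc n)
  M : PredModel (𝔉 (suc n))
  M = trivial-model (suc n)
  g : Var → ⊤
  g _ = tt

even-or-odd : (n : ℕ) → 2 ∣ n ⊎ 2 ∣ suc n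
even-or-odd zero    = inj₁ (divides 0 refl)
even-or-odd (suc n) with even-or-odd n
... | inj₁ 2∣n   = inj₂ (∣m∣n⇒∣m+n ∣-refl 2∣n)
... | inj₂ 2∣n+1 = inj₁ 2∣n+1

even⇒successor-odd : {n : ℕ} → 2 ∣ n → ¬ 2 ∣ suc n
even⇒successor-odd {n} 2∣n 2∣n+1
  with ∣1⇒≡1 (∣m+n∣m⇒∣n (subst (2 ∣_) (+-comm 1 n) 2∣n+1) 2∣n)
... | ()

lemma3 : (n : ℕ) → 1 ≤ n → L₀ (~ α n) ⇔ (2 ∣ n)
lemma3 n 1≤n = mk⇔ only-if if
  where
  -- even n: for N = 2m, n ≠ 1 (1 is odd) and n + 1 ≠ N (n + 1 is odd).
  if : 2 ∣ n → L₀ (~ α n)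
  if 2∣n m _ = not-α-valid (2 * m) n
    (λ { refl → even⇒successor-odd (divides 0 refl) 2∣n })
    (λ n+1≡2m → even⇒successor-odd 2∣n (subst (2 ∣_) (sym n+1≡2m) (m∣m*n m)))
  -- odd n: n + 1 = 2m with m ≥ 1, and 𝔉_{n+1} refutes ¬α_n.
  only-if : L₀ (~ α n) → 2 ∣ n
  only-if valid with even-or-odd n
  ... | inj₁ 2∣n = 2∣n
  ... | inj₂ (divides (suc m) n+1≡2m) =
    ⊥-elim (α-satisfiable n 1≤n
      (subst (λ N → ValidOn (𝔉 N) (~ α n)) (trans (*-comm 2 (suc m)) (sym n+1≡2m))
             (valid (suc m) (s≤s z≤n))))
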